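{- For every complete graph $G$ with $\Delta(G)\geq 3$ (i.e. $G=K_r$ with $r\ge 4$), $\chi(G^{\frac{3}{5}})=\omega(G^{\frac{3}{5}})$.
   Context: For a graph $G$ and positive integer $n$, the $n$-subdivision $G^{\frac{1}{n}}$ is obtained from $G$ by replacing each edge with a path of length $n$. For a graph $H$ and positive integer $m$, the $m$-th power $H^m$ is the graph on $V(H)$ in which two distinct vertices are adjacent iff their distance in $H$ is at most $m$. The fractional power is $G^{\frac{m}{n}}=(G^{\frac{1}{n}})^m$. $\chi$ denotes the chromatic number and $\omega$ the clique number. -}

module Defs where

open import Data.Nat using (ℕ; zero; suc; _+_; _∸_; _≤_)
open import Data.Fin using (Fin; toℕ) renaming (_<_ to _<ᶠ_)
open import Data.Bool using (Bool; true; false; T)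
open import Data.Sum using (_⊎_; inj₁; inj₂)
open import Data.Product using (Σ; _×_; _,_)
open import Relation.Binary.PropositionalEquality using (_≡_; _≢_; refl; sym)
open import Relation.Nullary using (yes; no)
open import Data.Empty using (⊥-elim)
open import Relation.Nullary using (¬_)
open import Data.Nat using (_≟_)
open import Data.Fin using () renaming (_≟_ to _≟ᶠ_)
open import Relation.Nullary.Decidable using (⌊_⌋)

record Graph : Set₁ where
  field
    V   : Set
    Adj : V → V → Set
open Graph public

Colorable : Graph → ℕ → Set
Colorable G k = Σ (V G → Fin k) λ c → ∀ x y → Adj G x y → c x ≢ c y

HasClique : Graph → ℕ → Set
HasClique G k = Σ (Fin k → V G) λ f →
  (∀ i j → f i ≡ f j → i ≡ j) × (∀ i j → i ≢ j → Adj G (f i) (f j))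

IsChromaticNumber : Graph → ℕ → Set
IsChromaticNumber G k = Colorable G k × (∀ j → Colorable G j → k ≤ j)

IsCliqueNumber : Graph → ℕ → Set
IsCliqueNumber G k = HasClique G k × (∀ j → HasClique G j → j ≤ k)

record SimpleGraph : Set where
  field
    n     : ℕ
    adj   : Fin n → Fin n → Bool
    adj-sym : ∀ u v → adj u v ≡ adj v u
    adj-irr : ∀ u → adj u u ≡ false
open SimpleGraph public

toGraph : SimpleGraph → Graph
toGraph G = record { V = Fin (n G) ; Adj = λ u v → T (adj G u v) }

K : ℕ → SimpleGraph
K r = record
  { n = r
  ; adj = λ u v → Data.Bool.not ⌊ u ≟ᶠ v ⌋
  ; adj-sym = symK
  ; adj-irr = irrK }
  where
  symK : ∀ (u v : Fin r) → Data.Bool.not ⌊ u ≟ᶠ v ⌋ ≡ Data.Bool.not ⌊ v ≟ᶠ u ⌋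
  symK u v with u ≟ᶠ v | v ≟ᶠ u
  ... | yes _ | yes _ = refl
  ... | no _  | no _  = refl
  ... | yes p | no q  = ⊥-elim (q (sym p))
  ... | no p  | yes q = ⊥-elim (p (sym q))
  irrK : ∀ (u : Fin r) → Data.Bool.not ⌊ u ≟ᶠ u ⌋ ≡ false
  irrK u with u ≟ᶠ u
  ... | yes _ = refl
  ... | no p  = ⊥-elim (p refl)

-- The m-subdivision G^{1/m}: each edge uv (oriented canonically with
-- u < v) is replaced by a path u = p₀, p₁, …, p_m = v; the internal
-- vertices p₁ … p_{m-1} are the vertices (e , i) with i : Fin (m ∸ 1),
-- (e , i) standing for p_{i+1}.

record Edge (G : SimpleGraph) : Set where
  constructor edge
  field
    src : Fin (n G)
    tgt : Fin (n G)
    lt  : src <ᶠ tgt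
    isE : T (adj G src tgt)

SubV : SimpleGraph → ℕ → Set
SubV G m = Fin (n G) ⊎ (Edge G × Fin (m ∸ 1))

data Step (G : SimpleGraph) (m : ℕ) : SubV G m → SubV G m → Set where
  direct : ∀ (e : Edge G) → m ≡ 1 →
           Step G m (inj₁ (Edge.src e)) (inj₁ (Edge.tgt e))
  first  : ∀ (e : Edge G) (i : Fin (m ∸ 1)) → toℕ i ≡ 0 →
           Step G m (inj₁ (Edge.src e)) (inj₂ (e , i))
  middle : ∀ (e : Edge G) (i j : Fin (m ∸ 1)) → toℕ j ≡ suc (toℕ i) →
           Step G m (inj₂ (e , i)) (inj₂ (e , j))
  last   : ∀ (e : Edge G) (i : Fin (m ∸ 1)) → suc (suc (toℕ i)) ≡ m →
           Step G m (inj₂ (e , i)) (inj₁ (Edge.tgt e))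

Subdivision : SimpleGraph → ℕ → Graph
Subdivision G m = record
  { V = SubV G m
  ; Adj = λ x y → Step G m x y ⊎ Step G m y x }

data WalkLe (H : Graph) : ℕ → V H → V H → Set where
  here : ∀ {k x} → WalkLe H k x x
  step : ∀ {k x y z} → Adj H x y → WalkLe H k y z → WalkLe H (suc k) x z

Power : Graph → ℕ → Graph
Power H m = record
  { V = V H
  ; Adj = λ x y → (x ≢ y) × WalkLe H m x y }

FracPower : SimpleGraph → ℕ → ℕ → Graph
FracPower G m k = Power (Subdivision G k) m

module Submission where

open import Defs
open import Data.Nat using (ℕ; zero; suc; _+_; _∸_; _≤_; _<_; s≤s; z≤n)
open import Data.Nat.Properties
  using (≤-refl; ≤-reflexive; ≤-trans; n≤1+n; m≤n+m; +-suc; +-monoʳ-≤; <-irrefl; <-asym; <-irrelevant; m≢1+n+m; ≤ᵇ⇒≤)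
open import Data.Fin using (Fin; zero; suc; toℕ; fromℕ; inject₁; #_; _≟_)
open import Data.Fin.Properties using (all?; 0≢1+n; suc-injective; fromℕ≢inject₁; inject₁-injective; toℕ-inject₁; injective⇒≤)
open import Data.Vec using (Vec; []; _∷_; lookup)
open import Data.Bool.Properties using (T-irrelevant)
open import Data.Product using (∃; ∃-syntax; _×_; _,_; proj₁; proj₂; swap)
open import Data.Sum using (_⊎_; inj₁; inj₂)
open import Data.Sum.Properties using (inj₂-injective)
open import Data.Product.Properties using (,-injectiveˡ; ,-injectiveʳ)
open import Data.Unit using (tt)
open import Data.Empty using (⊥-elim)
open import Function using (_∘_)
open import Relation.Nullary using (¬_; Dec; yes; no; ¬?)
open import Relation.Nullary.Decidable using (toWitness; _→-dec_)
open import Relation.Binary.PropositionalEquality using (_≡_; _≢_; refl; sym; trans; cong; cong₂; subst₂)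

-- Let r ≥ 4 and P = (K_r)^{3/5}: every edge uw of K_r becomes a path
-- u p₁ p₂ p₃ p₄ w, and vertices at distance ≤ 3 are joined.  We show χ(P) = ω(P) = r + 1.
-- * Lower bound: the centre 0, the vertex p₁ next to 0 on every edge 0u and the
--   vertex p₂ on the edge 01 are pairwise within distance 3 through 0, a clique of
--   size r + 1.
-- * Upper bound: all branch vertices get an extra colour r.  On the path of uw the
--   vertex at distance 2 from u gets colour u and the vertex at distance 1 from u
--   gets F(u,w), where F is a good labelling of ordered pairs (F(u,w) ∉ {u,w},
--   injective in w, F(u,w) ≠ F(w,u)); it exists for r ≥ 4 by a table on Fin 4 and an
--   extension step r ↦ r + 1.  For two vertices of equal colour some branch vertex a
--   sees them at "distance" potentials differing by at least 4; as the potential is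
--   1-Lipschitz along edges, they are at distance ≥ 4, hence not adjacent in P.
-- The file develops, in order: cliques versus colourings in any graph, walks and
-- 1-Lipschitz potentials, good labellings, the colour clash lemma on one subdivided
-- edge, the colouring of G^{3/5} for any G with a good labelling, the clique in
-- (K r)^{3/5}, and finally the theorem.

-- The vertices of a clique receive pairwise distinct colours.
clique≤colours : (H : Graph) {m k : ℕ} → HasClique H m → Colorable H k → m ≤ k
clique≤colours H (f , _ , f-adj) (c , c-proper) = injective⇒≤ colours-distinct
  where
  colours-distinct : ∀ {i j} → c (f i) ≡ c (f j) → i ≡ j
  colours-distinct {i} {j} same with i ≟ j
  ... | yes i≡j = i≡j
  ... | no i≢j = ⊥-elim (c-proper (f i) (f j) (f-adj i j i≢j) same)

χ≡ω-by-witnesses : (H : Graph) (k : ℕ) → HasClique H k → Colorable H k →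
                   IsChromaticNumber H k × IsCliqueNumber H k
χ≡ω-by-witnesses H k clique colouring =
  (colouring , λ _ other → clique≤colours H clique other) ,
  (clique , λ _ other → clique≤colours H other colouring)

walk-weaken : ∀ {H k l x y} → WalkLe H k x y → k ≤ l → WalkLe H l x y
walk-weaken here _ = here
walk-weaken (step a w) (s≤s k≤l) = step a (walk-weaken w k≤l)

walk-append : ∀ {H k l x y z} → WalkLe H k x y → WalkLe H l y z → WalkLe H (k + l) x z
walk-append {k = k} {l} here w = walk-weaken w (m≤n+m l k)
walk-append (step a w) w′ = step a (walk-append w w′)

Close : ℕ → ℕ → Set
Close m n = m ≤ suc n × n ≤ suc m

close-refl : ∀ n → Close n n
close-refl n = n≤1+n n , n≤1+n n

close-suc : ∀ n → Close n (suc n)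
close-suc n = ≤-trans (n≤1+n n) (n≤1+n (suc n)) , ≤-refl

close-sym : ∀ {m n} → Close m n → Close n m
close-sym = swap

OneLipschitz : (H : Graph) → (V H → ℕ) → Set
OneLipschitz H δ = ∀ {x y} → Adj H x y → Close (δ x) (δ y)

walk-bound : ∀ {H δ} → OneLipschitz H δ → ∀ {k x y} → WalkLe H k x y →
             δ y ≤ k + δ x × δ x ≤ k + δ y
walk-bound {δ = δ} lip {k} {x} here = m≤n+m (δ x) k , m≤n+m (δ x) k
walk-bound {δ = δ} lip {suc k} {x} {z} (step {y = y} xy w) =
  ≤-trans z-from-y (≤-trans (+-monoʳ-≤ k y≤x+1) (≤-reflexive (+-suc k (δ x)))) ,
  ≤-trans x≤y+1 (s≤s y-from-z)
  where
  z-from-y : δ z ≤ k + δ y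
  z-from-y = proj₁ (walk-bound lip w)
  y-from-z : δ y ≤ k + δ z
  y-from-z = proj₂ (walk-bound lip w)
  x≤y+1 : δ x ≤ suc (δ y)
  x≤y+1 = proj₁ (lip xy)
  y≤x+1 : δ y ≤ suc (δ x)
  y≤x+1 = proj₂ (lip xy)

Apart : ℕ → ℕ → ℕ → Set
Apart k m n = suc k + m ≤ n ⊎ suc k + n ≤ m

apart-sym : ∀ {k m n} → Apart k m n → Apart k n m
apart-sym (inj₁ h) = inj₂ h
apart-sym (inj₂ h) = inj₁ h

apart⇒no-walk : ∀ {H δ} → OneLipschitz H δ → ∀ {k x y} →
                Apart k (δ x) (δ y) → ¬ WalkLe H k x y
apart⇒no-walk lip (inj₁ gap) w = <-irrefl refl (≤-trans gap (proj₁ (walk-bound lip w)))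
apart⇒no-walk lip (inj₂ gap) w = <-irrefl refl (≤-trans gap (proj₂ (walk-bound lip w)))

-- Good labellings of ordered pairs

record GoodLabelling (r : ℕ) (F : Fin r → Fin r → Fin r) : Set where
  field
    avoids-fst : ∀ u w → u ≢ w → F u w ≢ u
    avoids-snd : ∀ u w → u ≢ w → F u w ≢ w
    injective  : ∀ u w w′ → u ≢ w → u ≢ w′ → F u w ≡ F u w′ → w ≡ w′
    asymmetric : ∀ u w → u ≢ w → F u w ≢ F w u

-- A good labelling of Fin 4 (none exists on Fin 3), checked by exhaustion.
base-table : Vec (Vec (Fin 4) 4) 4
base-table = (# 0 ∷ # 2 ∷ # 3 ∷ # 1 ∷ [])
           ∷ (# 3 ∷ # 1 ∷ # 0 ∷ # 2 ∷ [])
           ∷ (# 1 ∷ # 3 ∷ # 2 ∷ # 0 ∷ [])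
           ∷ (# 2 ∷ # 0 ∷ # 1 ∷ # 3 ∷ []) ∷ []

base : Fin 4 → Fin 4 → Fin 4
base u w = lookup (lookup base-table u) w

base-good : GoodLabelling 4 base
base-good = record
  { avoids-fst = toWitness {a? = all? λ u → all? λ w →
      ¬? (u ≟ w) →-dec ¬? (base u w ≟ u)} _
  ; avoids-snd = toWitness {a? = all? λ u → all? λ w →
      ¬? (u ≟ w) →-dec ¬? (base u w ≟ w)} _
  ; injective = toWitness {a? = all? λ u → all? λ w → all? λ w′ →
      ¬? (u ≟ w) →-dec ¬? (u ≟ w′) →-dec (base u w ≟ base u w′) →-dec (w ≟ w′)} _
  ; asymmetric = toWitness {a? = all? λ u → all? λ w →
      ¬? (u ≟ w) →-dec ¬? (base u w ≟ base w u)} _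
  }

rotate : ∀ {k} → Fin (suc k) → Fin (suc k)
rotate {k} zero = fromℕ k
rotate (suc i) = inject₁ i

rotate-injective : ∀ {k} (i j : Fin (suc k)) → rotate i ≡ rotate j → i ≡ j
rotate-injective zero zero _ = refl
rotate-injective zero (suc j) eq = ⊥-elim (fromℕ≢inject₁ eq)
rotate-injective (suc i) zero eq = ⊥-elim (fromℕ≢inject₁ (sym eq))
rotate-injective (suc i) (suc j) eq = cong suc (inject₁-injective eq)

rotate-moves : ∀ {m} (i : Fin (3 + m)) → i ≢ rotate i
rotate-moves zero ()
rotate-moves (suc i) eq = m≢1+n+m (toℕ i) {0} (sym (trans (cong toℕ eq) (toℕ-inject₁ i)))

rotate²-moves : ∀ {m} (i : Fin (3 + m)) → i ≢ rotate (rotate i)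
rotate²-moves zero ()
rotate²-moves (suc zero) ()
rotate²-moves (suc (suc i)) eq =
  m≢1+n+m (toℕ i) {1} (sym (trans (cong toℕ eq) (trans (toℕ-inject₁ (inject₁ i)) (toℕ-inject₁ i))))

relabel : ∀ {A : Set} {k} → Dec A → Fin k → Fin (suc k)
relabel (yes _) _ = zero
relabel (no _) x = suc x

-- Extension by a new vertex 0 in front of Fin (3 + m): the new vertex labels w
-- by rotate w, and an old vertex v hands its label F v (rotate v) over to the
-- pair (v , new vertex) while the pair (v , rotate v) is labelled by the new vertex.
extend : ∀ {m} → (Fin (3 + m) → Fin (3 + m) → Fin (3 + m)) →
         Fin (4 + m) → Fin (4 + m) → Fin (4 + m)
extend F zero    zero    = zero
extend F zero    (suc w) = suc (rotate w)
extend F (suc v) zero    = suc (F v (rotate v))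
extend F (suc v) (suc w) = relabel (w ≟ rotate v) (F v w)

module Extension {m : ℕ} {F : Fin (3 + m) → Fin (3 + m) → Fin (3 + m)}
                 (good : GoodLabelling (3 + m) F) where
  open GoodLabelling good

  distinct-pred : ∀ {v w : Fin (3 + m)} → suc v ≢ suc w → v ≢ w
  distinct-pred ne = ne ∘ cong suc

  avoids-fst′ : ∀ u w → u ≢ w → extend F u w ≢ u
  avoids-fst′ zero zero ne = ⊥-elim (ne refl)
  avoids-fst′ zero (suc w) _ ()
  avoids-fst′ (suc v) zero _ eq = avoids-fst v (rotate v) (rotate-moves v) (suc-injective eq)
  avoids-fst′ (suc v) (suc w) ne with w ≟ rotate v
  ... | yes _ = λ ()
  ... | no _ = avoids-fst v w (distinct-pred ne) ∘ suc-injective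

  avoids-snd′ : ∀ u w → u ≢ w → extend F u w ≢ w
  avoids-snd′ zero zero ne = ⊥-elim (ne refl)
  avoids-snd′ zero (suc w) _ eq = rotate-moves w (sym (suc-injective eq))
  avoids-snd′ (suc v) zero _ ()
  avoids-snd′ (suc v) (suc w) ne with w ≟ rotate v
  ... | yes _ = λ ()
  ... | no _ = avoids-snd v w (distinct-pred ne) ∘ suc-injective

  injective′ : ∀ u w w′ → u ≢ w → u ≢ w′ → extend F u w ≡ extend F u w′ → w ≡ w′
  injective′ zero zero _ ne _ _ = ⊥-elim (ne refl)
  injective′ zero (suc _) zero _ ne _ = ⊥-elim (ne refl)
  injective′ zero (suc a) (suc b) _ _ eq = cong suc (rotate-injective a b (suc-injective eq))
  injective′ (suc v) zero zero _ _ _ = refl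
  injective′ (suc v) zero (suc b) _ ne′ with b ≟ rotate v
  ... | yes _ = λ ()
  ... | no b≢ρv = λ eq → ⊥-elim (b≢ρv (sym (injective v (rotate v) b (rotate-moves v)
                                             (distinct-pred ne′) (suc-injective eq))))
  injective′ (suc v) (suc a) zero ne _ with a ≟ rotate v
  ... | yes _ = λ ()
  ... | no a≢ρv = λ eq → ⊥-elim (a≢ρv (injective v a (rotate v) (distinct-pred ne)
                                         (rotate-moves v) (suc-injective eq)))
  injective′ (suc v) (suc a) (suc b) ne ne′ with a ≟ rotate v | b ≟ rotate v
  ... | yes a≡ρv | yes b≡ρv = λ _ → cong suc (trans a≡ρv (sym b≡ρv))
  ... | yes _ | no _ = λ ()
  ... | no _ | yes _ = λ ()
  ... | no _ | no _ = λ eq →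
    cong suc (injective v a b (distinct-pred ne) (distinct-pred ne′) (suc-injective eq))

  asymmetric′ : ∀ u w → u ≢ w → extend F u w ≢ extend F w u
  asymmetric′ zero zero ne = ⊥-elim (ne refl)
  asymmetric′ zero (suc w) _ eq = avoids-snd w (rotate w) (rotate-moves w) (sym (suc-injective eq))
  asymmetric′ (suc v) zero _ eq = avoids-snd v (rotate v) (rotate-moves v) (suc-injective eq)
  asymmetric′ (suc v) (suc w) ne with w ≟ rotate v | v ≟ rotate w
  ... | yes w≡ρv | yes v≡ρw = ⊥-elim (rotate²-moves v (trans v≡ρw (cong rotate w≡ρv)))
  ... | yes _ | no _ = λ ()
  ... | no _ | yes _ = λ ()
  ... | no _ | no _ = asymmetric v w (distinct-pred ne) ∘ suc-injective

  extend-good : GoodLabelling (4 + m) (extend F)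
  extend-good = record
    { avoids-fst = avoids-fst′ ; avoids-snd = avoids-snd′
    ; injective = injective′ ; asymmetric = asymmetric′ }

good-labelling : (t : ℕ) → ∃ (GoodLabelling (4 + t))
good-labelling zero = base , base-good
good-labelling (suc t) = extend (proj₁ (good-labelling t)) , Extension.extend-good (proj₂ (good-labelling t))

-- Colours and potentials of the vertices of a subdivided edge uw,
-- described from the nearer end u

-- An internal vertex of a 5-subdivided edge lies at distance one or two
-- from its nearer end.
data Depth : Set where
  one two : Depth

depth : Depth → ℕ
depth one = 1
depth two = 2

module HalfEdges {r : ℕ} where

  halfColour : (Fin r → Fin r → Fin r) → Fin r → Fin r → Depth → Fin r
  halfColour F u w one = F u w
  halfColour F u w two = u

  branchPot : Fin r → Fin r → ℕ
  branchPot a b with a ≟ b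
  ... | yes _ = 0
  ... | no _ = 5

  halfPot : Fin r → Fin r → Fin r → Depth → ℕ
  halfPot a u w d with a ≟ u | a ≟ w
  ... | yes _ | _     = depth d
  ... | no _  | yes _ = 5 ∸ depth d
  ... | no _  | no _  = 5 + depth d

  branchPot-self : ∀ a → branchPot a a ≡ 0
  branchPot-self a with a ≟ a
  ... | yes _ = refl
  ... | no a≢a = ⊥-elim (a≢a refl)

  branchPot-other : ∀ {a b} → a ≢ b → branchPot a b ≡ 5
  branchPot-other {a} {b} a≢b with a ≟ b
  ... | yes a≡b = ⊥-elim (a≢b a≡b)
  ... | no _ = refl

  halfPot-near : ∀ u w d → halfPot u u w d ≡ depth d
  halfPot-near u w d with u ≟ u
  ... | yes _ = refl
  ... | no u≢u = ⊥-elim (u≢u refl)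

  halfPot-far : ∀ {u w} d → u ≢ w → halfPot w u w d ≡ 5 ∸ depth d
  halfPot-far {u} {w} d u≢w with w ≟ u | w ≟ w
  ... | yes w≡u | _ = ⊥-elim (u≢w (sym w≡u))
  ... | no _ | yes _ = refl
  ... | no _ | no w≢w = ⊥-elim (w≢w refl)

  halfPot-away : ∀ {a u w} d → a ≢ u → a ≢ w → halfPot a u w d ≡ 5 + depth d
  halfPot-away {a} {u} {w} d a≢u a≢w with a ≟ u | a ≟ w
  ... | yes a≡u | _ = ⊥-elim (a≢u a≡u)
  ... | no _ | yes a≡w = ⊥-elim (a≢w a≡w)
  ... | no _ | no _ = refl

  -- The potentials are 1-Lipschitz along the path u p₁ p₂ p₃ p₄ w: leaving the
  -- branch vertex u, going one step deeper, and crossing the middle edge p₂p₃.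
  leave-close : ∀ a u w → Close (branchPot a u) (halfPot a u w one)
  leave-close a u w with a ≟ u | a ≟ w
  ... | yes _ | _ = close-suc 0
  ... | no _ | yes _ = close-sym (close-suc 4)
  ... | no _ | no _ = close-suc 5

  deeper-close : ∀ a u w → Close (halfPot a u w one) (halfPot a u w two)
  deeper-close a u w with a ≟ u | a ≟ w
  ... | yes _ | _ = close-suc 1
  ... | no _ | yes _ = close-sym (close-suc 3)
  ... | no _ | no _ = close-suc 6

  middle-close : ∀ a {u w} → u ≢ w → Close (halfPot a u w two) (halfPot a w u two)
  middle-close a {u} {w} u≢w with a ≟ u | a ≟ w
  ... | yes a≡u | yes a≡w = ⊥-elim (u≢w (trans (sym a≡u) a≡w))
  ... | yes _ | no _ = close-suc 2
  ... | no _ | yes _ = close-sym (close-suc 2)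
  ... | no _ | no _ = close-refl 7

  module Clash {F : Fin r → Fin r → Fin r} (good : GoodLabelling r F) where
    open GoodLabelling good

    SamePlace : Fin r → Fin r → Depth → Fin r → Fin r → Depth → Set
    SamePlace u w d u′ w′ d′ = u ≡ u′ × w ≡ w′ × d ≡ d′

    Separated : Fin r → Fin r → Depth → Fin r → Fin r → Depth → Set
    Separated u w d u′ w′ d′ = ∃ λ a → Apart 3 (halfPot a u w d) (halfPot a u′ w′ d′)

    separated-by : ∀ a {u w d u′ w′ d′ m n} →
                   halfPot a u w d ≡ m → halfPot a u′ w′ d′ ≡ n → Apart 3 m n →
                   Separated u w d u′ w′ d′
    separated-by a p q gap = a , subst₂ (Apart 3) (sym p) (sym q) gap

    separated-sym : ∀ {u w d u′ w′ d′} → Separated u w d u′ w′ d′ → Separated u′ w′ d′ u w d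
    separated-sym (a , gap) = a , apart-sym gap

    -- The colour u′ = F u w avoids u and w, so u′ sees the two vertices at
    -- potentials 6 and 2.
    clash-one-two : ∀ u w u′ w′ → u ≢ w → F u w ≡ u′ → Separated u w one u′ w′ two
    clash-one-two u w u′ w′ u≢w eq =
      separated-by u′ (halfPot-away one u′≢u u′≢w) (halfPot-near u′ w′ two) (inj₂ ≤-refl)
      where
      u′≢u : u′ ≢ u
      u′≢u u′≡u = avoids-fst u w u≢w (trans eq u′≡u)
      u′≢w : u′ ≢ w
      u′≢w u′≡w = avoids-snd u w u≢w (trans eq u′≡w)

    -- Depth one twice: equal near ends give the same place by injectivity of F;
    -- otherwise a near end that is not an end of the other edge (reversed edges are
    -- excluded by asymmetry) sees potentials 1 and 6.  Depth two twice: the near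
    -- ends agree (both are the colour), and the far end of the first edge sees 3 and 7.
    clash : ∀ u w d u′ w′ d′ → u ≢ w → u′ ≢ w′ →
            halfColour F u w d ≡ halfColour F u′ w′ d′ →
            SamePlace u w d u′ w′ d′ ⊎ Separated u w d u′ w′ d′
    clash u w one u′ w′ one u≢w u′≢w′ eq with u ≟ u′
    ... | yes refl = inj₁ (refl , injective u w w′ u≢w u′≢w′ eq , refl)
    ... | no u≢u′ with u ≟ w′
    ...   | no u≢w′ =
      inj₂ (separated-by u (halfPot-near u w one) (halfPot-away one u≢u′ u≢w′) (inj₁ (n≤1+n 5)))
    ...   | yes u≡w′ with u′ ≟ w
    ...     | no u′≢w =
      inj₂ (separated-by u′ (halfPot-away one (u≢u′ ∘ sym) u′≢w) (halfPot-near u′ w′ one) (inj₂ (n≤1+n 5)))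
    ...     | yes u′≡w = ⊥-elim (asymmetric u w u≢w (trans eq (cong₂ F u′≡w (sym u≡w′))))
    clash u w one u′ w′ two u≢w _ eq = inj₂ (clash-one-two u w u′ w′ u≢w eq)
    clash u w two u′ w′ one _ u′≢w′ eq = inj₂ (separated-sym (clash-one-two u′ w′ u w u′≢w′ (sym eq)))
    clash u w two .u w′ two u≢w _ refl with w ≟ w′
    ... | yes w≡w′ = inj₁ (refl , w≡w′ , refl)
    ... | no w≢w′ =
      inj₂ (separated-by w (halfPot-far two u≢w) (halfPot-away two (u≢w ∘ sym) w≢w′) (inj₁ ≤-refl))

-- A proper (n + 1)-colouring of G^{3/5} for a graph G on n vertices
-- carrying a good labelling

module FivePower (G : SimpleGraph) {F : Fin (n G) → Fin (n G) → Fin (n G)}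
                 (good : GoodLabelling (n G) F) where
  open HalfEdges {n G}
  open Clash good

  Vertex : Set
  Vertex = SubV G 5

  src tgt : Edge G → Fin (n G)
  src = Edge.src
  tgt = Edge.tgt

  src≢tgt : (e : Edge G) → src e ≢ tgt e
  src≢tgt e eq = <-irrefl (cong toℕ eq) (Edge.lt e)

  -- edges are stored with src < tgt, so no edge is the reverse of another
  no-reversal : (e e′ : Edge G) → src e ≡ tgt e′ → tgt e ≢ src e′
  no-reversal e e′ p q = <-asym (subst₂ _<_ (cong toℕ p) (cong toℕ q) (Edge.lt e)) (Edge.lt e′)

  edge-ext : (e e′ : Edge G) → src e ≡ src e′ → tgt e ≡ tgt e′ → e ≡ e′
  edge-ext (edge s t lt isE) (edge .s .t lt′ isE′) refl refl =
    cong₂ (edge s t) (<-irrelevant lt lt′) (T-irrelevant isE isE′)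

  -- The internal vertex (e , pᵢ) is the i-th vertex of the path replacing e,
  -- read from src e towards tgt e.
  pattern p₁ = zero
  pattern p₂ = suc zero
  pattern p₃ = suc (suc zero)
  pattern p₄ = suc (suc (suc zero))

  nearEnd farEnd : Edge G → Fin 4 → Fin (n G)
  nearEnd e p₁ = src e
  nearEnd e p₂ = src e
  nearEnd e p₃ = tgt e
  nearEnd e p₄ = tgt e
  farEnd e p₁ = tgt e
  farEnd e p₂ = tgt e
  farEnd e p₃ = src e
  farEnd e p₄ = src e

  depthOf : Fin 4 → Depth
  depthOf p₁ = one
  depthOf p₂ = two
  depthOf p₃ = two
  depthOf p₄ = one

  nearEnd≢farEnd : ∀ e i → nearEnd e i ≢ farEnd e i
  nearEnd≢farEnd e p₁ = src≢tgt e
  nearEnd≢farEnd e p₂ = src≢tgt e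
  nearEnd≢farEnd e p₃ = src≢tgt e ∘ sym
  nearEnd≢farEnd e p₄ = src≢tgt e ∘ sym

  position-injective : ∀ e i e′ j → nearEnd e i ≡ nearEnd e′ j → farEnd e i ≡ farEnd e′ j →
                       depthOf i ≡ depthOf j → (e , i) ≡ (e′ , j)
  position-injective e p₁ e′ p₁ s t _ = cong (_, p₁) (edge-ext e e′ s t)
  position-injective e p₂ e′ p₂ s t _ = cong (_, p₂) (edge-ext e e′ s t)
  position-injective e p₃ e′ p₃ s t _ = cong (_, p₃) (edge-ext e e′ t s)
  position-injective e p₄ e′ p₄ s t _ = cong (_, p₄) (edge-ext e e′ t s)
  position-injective e p₁ e′ p₄ s t _ = ⊥-elim (no-reversal e e′ s t)
  position-injective e p₂ e′ p₃ s t _ = ⊥-elim (no-reversal e e′ s t)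
  position-injective e p₃ e′ p₂ s t _ = ⊥-elim (no-reversal e e′ t s)
  position-injective e p₄ e′ p₁ s t _ = ⊥-elim (no-reversal e e′ t s)
  position-injective e p₁ e′ p₂ _ _ ()
  position-injective e p₁ e′ p₃ _ _ ()
  position-injective e p₂ e′ p₁ _ _ ()
  position-injective e p₂ e′ p₄ _ _ ()
  position-injective e p₃ e′ p₁ _ _ ()
  position-injective e p₃ e′ p₄ _ _ ()
  position-injective e p₄ e′ p₂ _ _ ()
  position-injective e p₄ e′ p₃ _ _ ()

  potential : Fin (n G) → Vertex → ℕ
  potential a (inj₁ b) = branchPot a b
  potential a (inj₂ (e , i)) = halfPot a (nearEnd e i) (farEnd e i) (depthOf i)

  step-close : ∀ a {x y} → Step G 5 x y → Close (potential a x) (potential a y)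
  step-close a (direct e ())
  step-close a (first e p₁ _) = leave-close a (src e) (tgt e)
  step-close a (middle e p₁ p₂ _) = deeper-close a (src e) (tgt e)
  step-close a (middle e p₂ p₃ _) = middle-close a (src≢tgt e)
  step-close a (middle e p₃ p₄ _) = close-sym (deeper-close a (tgt e) (src e))
  step-close a (last e p₄ _) = close-sym (leave-close a (tgt e) (src e))
  step-close a (first e (suc _) ())
  step-close a (middle e _ p₁ ())
  step-close a (middle e p₁ p₃ ())
  step-close a (middle e p₁ p₄ ())
  step-close a (middle e p₂ p₂ ())
  step-close a (middle e p₂ p₄ ())
  step-close a (middle e p₃ p₂ ())
  step-close a (middle e p₃ p₃ ())
  step-close a (middle e p₄ p₂ ())
  step-close a (middle e p₄ p₃ ())
  step-close a (middle e p₄ p₄ ())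
  step-close a (last e p₁ ())
  step-close a (last e p₂ ())
  step-close a (last e p₃ ())

  potential-lipschitz : ∀ a → OneLipschitz (Subdivision G 5) (potential a)
  potential-lipschitz a (inj₁ s) = step-close a s
  potential-lipschitz a (inj₂ s) = close-sym (step-close a s)

  colour : Vertex → Fin (suc (n G))
  colour (inj₁ _) = fromℕ (n G)
  colour (inj₂ (e , i)) = inject₁ (halfColour F (nearEnd e i) (farEnd e i) (depthOf i))

  separated : ∀ x y → x ≢ y → colour x ≡ colour y → ∃ λ a → Apart 3 (potential a x) (potential a y)
  separated (inj₁ a) (inj₁ b) x≢y _ =
    a , subst₂ (Apart 3) (sym (branchPot-self a)) (sym (branchPot-other (x≢y ∘ cong inj₁))) (inj₁ (n≤1+n 4))
  separated (inj₁ _) (inj₂ _) _ eq = ⊥-elim (fromℕ≢inject₁ eq)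
  separated (inj₂ _) (inj₁ _) _ eq = ⊥-elim (fromℕ≢inject₁ (sym eq))
  separated (inj₂ (e , i)) (inj₂ (e′ , j)) x≢y eq
    with clash (nearEnd e i) (farEnd e i) (depthOf i) (nearEnd e′ j) (farEnd e′ j) (depthOf j)
               (nearEnd≢farEnd e i) (nearEnd≢farEnd e′ j) (inject₁-injective eq)
  ... | inj₁ (s , t , d) = ⊥-elim (x≢y (cong inj₂ (position-injective e i e′ j s t d)))
  ... | inj₂ gap = gap

  -- equal colours force distance ≥ 4 in G^{1/5}, so the colouring is proper
  colouring : Colorable (FracPower G 3 5) (suc (n G))
  colouring = colour , proper
    where
    proper : ∀ x y → Adj (FracPower G 3 5) x y → colour x ≢ colour y
    proper x y (x≢y , walk) same with separated x y x≢y same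
    ... | a , gap = apart⇒no-walk (potential-lipschitz a) gap walk

-- A clique of size r + 1 in (K r)^{3/5} for r ≥ 2

module CompleteClique (m : ℕ) where
  Sub : Graph
  Sub = Subdivision (K (2 + m)) 5

  spoke : Fin (suc m) → Edge (K (2 + m))
  spoke u = edge zero (suc u) (s≤s z≤n) tt

  centre : V Sub
  centre = inj₁ zero

  -- the centre, the second vertex on the first spoke, and the first vertex on every spoke
  member : Fin (3 + m) → V Sub
  member zero = centre
  member (suc zero) = inj₂ (spoke zero , # 1)
  member (suc (suc u)) = inj₂ (spoke u , # 0)

  reach : Fin (3 + m) → ℕ
  reach zero = 0
  reach (suc zero) = 2
  reach (suc (suc _)) = 1

  to-centre : ∀ i → WalkLe Sub (reach i) (member i) centre
  to-centre zero = here
  to-centre (suc zero) =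
    step (inj₂ (middle (spoke zero) (# 0) (# 1) refl)) (step (inj₂ (first (spoke zero) (# 0) refl)) here)
  to-centre (suc (suc u)) = step (inj₂ (first (spoke u) (# 0) refl)) here

  from-centre : ∀ i → WalkLe Sub (reach i) centre (member i)
  from-centre zero = here
  from-centre (suc zero) =
    step (inj₁ (first (spoke zero) (# 0) refl)) (step (inj₁ (middle (spoke zero) (# 0) (# 1) refl)) here)
  from-centre (suc (suc u)) = step (inj₁ (first (spoke u) (# 0) refl)) here

  -- only one member lies at distance 2 from the centre
  reach-sum : ∀ i j → i ≢ j → reach i + reach j ≤ 3
  reach-sum zero zero i≢j = ⊥-elim (i≢j refl)
  reach-sum zero (suc zero) _ = ≤ᵇ⇒≤ 2 3 tt
  reach-sum zero (suc (suc _)) _ = ≤ᵇ⇒≤ 1 3 tt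
  reach-sum (suc zero) zero _ = ≤ᵇ⇒≤ 2 3 tt
  reach-sum (suc zero) (suc zero) i≢j = ⊥-elim (i≢j refl)
  reach-sum (suc zero) (suc (suc _)) _ = ≤-refl
  reach-sum (suc (suc _)) zero _ = ≤ᵇ⇒≤ 1 3 tt
  reach-sum (suc (suc _)) (suc zero) _ = ≤-refl
  reach-sum (suc (suc _)) (suc (suc _)) _ = ≤ᵇ⇒≤ 2 3 tt

  member-injective : ∀ i j → member i ≡ member j → i ≡ j
  member-injective zero zero _ = refl
  member-injective zero (suc zero) ()
  member-injective zero (suc (suc _)) ()
  member-injective (suc zero) zero ()
  member-injective (suc (suc _)) zero ()
  member-injective (suc zero) (suc zero) _ = refl
  member-injective (suc zero) (suc (suc _)) eq = ⊥-elim (0≢1+n (sym (,-injectiveʳ (inj₂-injective eq))))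
  member-injective (suc (suc _)) (suc zero) eq = ⊥-elim (0≢1+n (,-injectiveʳ (inj₂-injective eq)))
  member-injective (suc (suc u)) (suc (suc u′)) eq =
    cong (λ v → suc (suc v)) (suc-injective (cong Edge.tgt (,-injectiveˡ (inj₂-injective eq))))

  -- any two members are joined through the centre by a walk of length ≤ 3
  clique : HasClique (FracPower (K (2 + m)) 3 5) (3 + m)
  clique = member , member-injective , adjacent
    where
    adjacent : ∀ i j → i ≢ j → Adj (FracPower (K (2 + m)) 3 5) (member i) (member j)
    adjacent i j i≢j = i≢j ∘ member-injective i j ,
                       walk-weaken (walk-append (to-centre i) (from-centre j)) (reach-sum i j i≢j)

lemma6p1 : (r : ℕ) → 4 ≤ r →
    ∃[ k ] (IsChromaticNumber (FracPower (K r) 3 5) k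
           × IsCliqueNumber (FracPower (K r) 3 5) k)
lemma6p1 _ (s≤s (s≤s (s≤s (s≤s {n = t} _)))) =
  5 + t , χ≡ω-by-witnesses (FracPower (K (4 + t)) 3 5) (5 + t) clique colouring
  where
  clique : HasClique (FracPower (K (4 + t)) 3 5) (5 + t)
  clique = CompleteClique.clique (2 + t)
  colouring : Colorable (FracPower (K (4 + t)) 3 5) (5 + t)
  colouring = FivePower.colouring (K (4 + t)) (proj₂ (good-labelling t))
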